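{- Let $f_1(X_1),\dots,f_k(X_k)$ be unate boolean functions on pairwise disjoint sets of variables $X_1,\dots,X_k$. Then (1) $uDNF_s\left(\bigwedge_{i=1}^k f_i\right)\ge\sum_{i=1}^k uDNF_s(f_i)$, and (2) $uCNF_s\left(\bigwedge_{i=1}^k f_i\right)=\sum_{i=1}^k uCNF_s(f_i)$.
   Context: A boolean function is unate if it is computed by a unate formula, i.e. a formula over $\wedge,\vee$ in which each variable appears only negated or only non-negated. $uDNF_s(g)$ (resp. $uCNF_s(g)$) is the minimum number of leaves (literal occurrences) of a unate DNF (resp. unate CNF) computing $g$. Standing assumption: each $f_i$ depends on all of the variables in $X_i$, and each $X_i$ is nonempty. -}

module Defs where

open import Data.Nat using (ℕ; zero; suc; _+_)
open import Data.Bool using (Bool; true; false; _∧_; _∨_; not; if_then_else_)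
open import Data.Fin using (Fin; zero; suc; _≟_)
open import Data.Fin.Subset using (Subset; _∈_)
open import Data.List using (List; []; _∷_; length; map)
open import Data.Nat.ListAction using (sum)
open import Data.List.Relation.Unary.All using (All)
open import Data.Product using (Σ; ∃; _×_; _,_)
open import Relation.Binary.PropositionalEquality using (_≡_; _≢_)
open import Relation.Nullary using (¬_; yes; no)
open import Data.Empty using (⊥)

Assignment : ℕ → Set
Assignment n = Fin n → Bool

BoolFun : ℕ → Set
BoolFun n = Assignment n → Bool

record Literal (n : ℕ) : Set where
  constructor lit
  field
    var  : Fin n
    sign : Bool
open Literal public

evalLit : ∀ {n} → Literal n → Assignment n → Bool
evalLit (lit v true)  a = a v
evalLit (lit v false) a = not (a v)

Consistent : ∀ {n} → (Fin n → Bool) → Literal n → Set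
Consistent σ l = sign l ≡ σ (var l)

data Formula (n : ℕ) : Set where
  leaf : Literal n → Formula n
  _∧ᶠ_ : Formula n → Formula n → Formula n
  _∨ᶠ_ : Formula n → Formula n → Formula n

evalF : ∀ {n} → Formula n → Assignment n → Bool
evalF (leaf l)  a = evalLit l a
evalF (φ ∧ᶠ ψ) a = evalF φ a ∧ evalF ψ a
evalF (φ ∨ᶠ ψ) a = evalF φ a ∨ evalF ψ a

AllLeaves : ∀ {n} → (Literal n → Set) → Formula n → Set
AllLeaves P (leaf l)  = P l
AllLeaves P (φ ∧ᶠ ψ) = AllLeaves P φ × AllLeaves P ψ
AllLeaves P (φ ∨ᶠ ψ) = AllLeaves P φ × AllLeaves P ψ

UnateFormula : ∀ {n} → Formula n → Set
UnateFormula {n} φ = Σ (Fin n → Bool) λ σ → AllLeaves (Consistent σ) φ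

ComputesF : ∀ {n} → Formula n → BoolFun n → Set
ComputesF φ g = ∀ a → evalF φ a ≡ g a

Unate : ∀ {n} → BoolFun n → Set
Unate {n} g = Σ (Formula n) λ φ → UnateFormula φ × ComputesF φ g

NF : ℕ → Set
NF n = List (List (Literal n))

-- number of leaves (literal occurrences)
size : ∀ {n} → NF n → ℕ
size F = sum (map length F)

allL : ∀ {n} → List (Literal n) → Assignment n → Bool
allL []       a = true
allL (l ∷ ls) a = evalLit l a ∧ allL ls a

anyL : ∀ {n} → List (Literal n) → Assignment n → Bool
anyL []       a = false
anyL (l ∷ ls) a = evalLit l a ∨ anyL ls a

evalDNF : ∀ {n} → NF n → Assignment n → Bool
evalDNF []       a = false
evalDNF (t ∷ ts) a = allL t a ∨ evalDNF ts a

evalCNF : ∀ {n} → NF n → Assignment n → Bool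
evalCNF []       a = true
evalCNF (c ∷ cs) a = anyL c a ∧ evalCNF cs a

UnateNF : ∀ {n} → NF n → Set
UnateNF {n} F = Σ (Fin n → Bool) λ σ → All (All (Consistent σ)) F

IsUDNF : ∀ {n} → NF n → BoolFun n → Set
IsUDNF F g = UnateNF F × (∀ a → evalDNF F a ≡ g a)

IsUCNF : ∀ {n} → NF n → BoolFun n → Set
IsUCNF F g = UnateNF F × (∀ a → evalCNF F a ≡ g a)

open import Data.Nat using (_≤_)

UDNFs : ∀ {n} → BoolFun n → ℕ → Set
UDNFs {n} g m =
  (Σ (NF n) λ F → IsUDNF F g × size F ≡ m) × (∀ (F : NF n) → IsUDNF F g → m ≤ size F)

UCNFs : ∀ {n} → BoolFun n → ℕ → Set
UCNFs {n} g m =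
  (Σ (NF n) λ F → IsUCNF F g × size F ≡ m) × (∀ (F : NF n) → IsUCNF F g → m ≤ size F)

flipAt : ∀ {n} → Fin n → Assignment n → Assignment n
flipAt v a w with w ≟ v
... | yes _ = not (a w)
... | no  _ = a w

DependsOnlyOn : ∀ {n} → BoolFun n → Subset n → Set
DependsOnlyOn {n} g X = ∀ (a b : Assignment n) → (∀ v → v ∈ X → a v ≡ b v) → g a ≡ g b

DependsOn : ∀ {n} → BoolFun n → Fin n → Set
DependsOn {n} g v = Σ (Assignment n) λ a → g a ≢ g (flipAt v a)

bigAnd : ∀ {n} k → (Fin k → BoolFun n) → BoolFun n
bigAnd zero    f a = true
bigAnd (suc k) f a = f zero a ∧ bigAnd k (λ i → f (suc i)) a

sumFin : ∀ k → (Fin k → ℕ) → ℕ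
sumFin zero    m = 0
sumFin (suc k) m = m zero + sumFin k (λ i → m (suc i))

-- Restricting a unate normal form of ⋀ fᵢ to the variables Xᵢ gives a normal form of fᵢ,
-- provided the variables outside Xᵢ are fixed at a point where every other conjunct holds
-- and the dropped literals are neutral there; as the Xᵢ are disjoint, the restrictions
-- together are no larger than the original. For a DNF with polarity σ, σ itself is such a
-- point: a satisfiable unate DNF holds at its polarity. For CNFs, concatenating the
-- restrictions of optimal CNFs of the fᵢ gives the upper bound. For the lower bound, every
-- clause c of a unate CNF of ⋀ fᵢ is implied, already on its Xⱼ-ownedClauses, by a single fⱼ;
-- sending each clause to such an owner and restricting yields CNFs of the fᵢ.

module Submission where

open import Defs
open import Data.Bool using (Bool; true; false; _∧_; _∨_; not; if_then_else_)
open import Data.Bool.Properties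
  using (∧-conicalˡ; ∧-conicalʳ; ∨-conicalˡ; ∨-conicalʳ; ∨-zeroʳ; ∧-identityʳ; ∧-assoc; ¬-not; not-¬; ⇔→≡)
open import Data.Empty using (⊥; ⊥-elim)
open import Data.Fin using (Fin; zero; suc; _≟_)
open import Data.Fin.Properties using (suc-injective; ∀-cons)
open import Data.Fin.Subset using (Subset; _∈_; _∉_)
open import Data.Fin.Subset.Properties using (_∈?_)
open import Data.List using (List; []; _∷_; _++_; length; map; filter)
open import Data.List.Properties using (length-filter; map-++)
open import Data.List.Relation.Unary.All as All using (All; []; _∷_)
open import Data.List.Relation.Unary.All.Properties using (++⁺; all-filter; filter⁺; map⁺)
open import Data.Nat using (ℕ; zero; suc; _+_; _≤_; _≤?_; z≤n; s≤s)
open import Data.Nat.ListAction using (sum)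
open import Data.Nat.ListAction.Properties using (sum-++)
open import Data.Nat.Properties
  using ( ≤-trans; ≤-reflexive; ≤-antisym; +-mono-≤; +-monoʳ-≤; m≤n+m; +-commutativeSemigroup
        ; module ≤-Reasoning)
open import Algebra.Properties.CommutativeSemigroup +-commutativeSemigroup using (interchange)
open import Data.Product using (∃; _×_; _,_; proj₁; proj₂)
open import Function using (_∘_)
open import Function.Bundles using (mk⇔)
open import Relation.Binary.PropositionalEquality
  using (_≡_; _≢_; refl; sym; trans; cong; cong₂; module ≡-Reasoning)
open import Relation.Nullary using (¬_; Dec; yes; no; does)
open import Relation.Nullary.Decidable using (decidable-stable)
open import Relation.Nullary.Negation using (¬¬-map)
open import Relation.Unary using (Decidable)

sumFin-+ : ∀ k (g h : Fin k → ℕ) → sumFin k (λ i → g i + h i) ≡ sumFin k g + sumFin k h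
sumFin-+ zero    g h = refl
sumFin-+ (suc k) g h = begin
  (g zero + h zero) + sumFin k (λ i → g (suc i) + h (suc i))
    ≡⟨ cong (g zero + h zero +_) (sumFin-+ k (g ∘ suc) (h ∘ suc)) ⟩
  (g zero + h zero) + (sumFin k (g ∘ suc) + sumFin k (h ∘ suc))
    ≡⟨ interchange (g zero) (h zero) _ _ ⟩
  (g zero + sumFin k (g ∘ suc)) + (h zero + sumFin k (h ∘ suc)) ∎
  where open ≡-Reasoning

sumFin-mono : ∀ k {g h : Fin k → ℕ} → (∀ i → g i ≤ h i) → sumFin k g ≤ sumFin k h
sumFin-mono zero    g≤h = z≤n
sumFin-mono (suc k) g≤h = +-mono-≤ (g≤h zero) (sumFin-mono k (g≤h ∘ suc))

sumFin-zero : ∀ k {g : Fin k → ℕ} → (∀ i → g i ≡ 0) → sumFin k g ≡ 0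
sumFin-zero zero    g≡0 = refl
sumFin-zero (suc k) g≡0 = cong₂ _+_ (g≡0 zero) (sumFin-zero k (g≡0 ∘ suc))

PairwiseDisjoint : ∀ {A : Set} {k} → (Fin k → A → Set) → Set
PairwiseDisjoint {A} {k} P = ∀ (i j : Fin k) → i ≢ j → ∀ (x : A) → P i x → P j x → ⊥

PairwiseDisjoint-suc : ∀ {A : Set} {k} {P : Fin (suc k) → A → Set} →
                       PairwiseDisjoint P → PairwiseDisjoint (P ∘ suc)
PairwiseDisjoint-suc disjoint i j i≢j = disjoint (suc i) (suc j) (i≢j ∘ suc-injective)

indicator : ∀ {P : Set} → Dec P → ℕ
indicator d = if does d then 1 else 0

sumFin-indicator-≤1 : ∀ {A : Set} k {P : Fin k → A → Set} (P? : ∀ i → Decidable (P i)) →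
                      PairwiseDisjoint P → ∀ x → sumFin k (λ i → indicator (P? i x)) ≤ 1
sumFin-indicator-≤1 zero    P? disjoint x = z≤n
sumFin-indicator-≤1 (suc k) P? disjoint x with P? zero x
... | yes Px = s≤s (≤-reflexive (sumFin-zero k excluded))
  where
  excluded : ∀ i → indicator (P? (suc i) x) ≡ 0
  excluded i with P? (suc i) x
  ... | yes Pix = ⊥-elim (disjoint zero (suc i) (λ ()) x Px Pix)
  ... | no _    = refl
... | no _ = sumFin-indicator-≤1 k (P? ∘ suc) (PairwiseDisjoint-suc disjoint) x

length-filter-∷ : ∀ {A : Set} {P : A → Set} (P? : Decidable P) x xs →
                  length (filter P? (x ∷ xs)) ≡ indicator (P? x) + length (filter P? xs)
length-filter-∷ P? x xs with does (P? x)
... | true  = refl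
... | false = refl

sumFin-length-filter : ∀ {A : Set} k {P : Fin k → A → Set} (P? : ∀ i → Decidable (P i)) →
                       PairwiseDisjoint P → ∀ xs → sumFin k (λ i → length (filter (P? i) xs)) ≤ length xs
sumFin-length-filter k P? disjoint []       = ≤-reflexive (sumFin-zero k (λ _ → refl))
sumFin-length-filter k P? disjoint (x ∷ xs) = begin
  sumFin k (λ i → length (filter (P? i) (x ∷ xs)))
    ≤⟨ sumFin-mono k (λ i → ≤-reflexive (length-filter-∷ (P? i) x xs)) ⟩
  sumFin k (λ i → indicator (P? i x) + length (filter (P? i) xs))
    ≡⟨ sumFin-+ k _ _ ⟩
  sumFin k (λ i → indicator (P? i x)) + sumFin k (λ i → length (filter (P? i) xs))
    ≤⟨ +-mono-≤ (sumFin-indicator-≤1 k P? disjoint x) (sumFin-length-filter k P? disjoint xs) ⟩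
  1 + length xs ∎
  where open ≤-Reasoning

¬¬-∀Fin : ∀ k {P : Fin k → Set} → (∀ i → ¬ ¬ P i) → ¬ ¬ (∀ i → P i)
¬¬-∀Fin zero    _   ¬all = ¬all (λ ())
¬¬-∀Fin (suc k) ¬¬P ¬all = ¬¬P zero (λ P₀ → ¬¬-∀Fin k (¬¬P ∘ suc) (λ Pₛ → ¬all (∀-cons P₀ Pₛ)))

¬¬-All : ∀ {A : Set} {P : A → Set} xs → All (λ x → ¬ ¬ P x) xs → ¬ ¬ All P xs
¬¬-All []       []          ¬all = ¬all []
¬¬-All (x ∷ xs) (¬¬p ∷ ¬¬ps) ¬all = ¬¬p (λ p → ¬¬-All xs ¬¬ps (λ ps → ¬all (p ∷ ps)))

Agree : ∀ {n} → Subset n → Assignment n → Assignment n → Set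
Agree X a b = ∀ v → v ∈ X → a v ≡ b v

merge : ∀ {n} → Subset n → Assignment n → Assignment n → Assignment n
merge X a b v = if does (v ∈? X) then a v else b v

merge-∈ : ∀ {n} (X : Subset n) a b {v} → v ∈ X → merge X a b v ≡ a v
merge-∈ X a b {v} v∈X with v ∈? X
... | yes _   = refl
... | no v∉X = ⊥-elim (v∉X v∈X)

merge-∉ : ∀ {n} (X : Subset n) a b {v} → v ∉ X → merge X a b v ≡ b v
merge-∉ X a b {v} v∉X with v ∈? X
... | yes v∈X = ⊥-elim (v∉X v∈X)
... | no _    = refl

glue : ∀ {n} k → (Fin k → Subset n) → (Fin k → Assignment n) → Assignment n → Assignment n
glue zero    X a d = d
glue (suc k) X a d = merge (X zero) (a zero) (glue k (X ∘ suc) (a ∘ suc) d)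

glue-∈ : ∀ {n} k (X : Fin k → Subset n) a d → PairwiseDisjoint (λ i v → v ∈ X i) →
         ∀ j {v} → v ∈ X j → glue k X a d v ≡ a j v
glue-∈ (suc k) X a d disjoint zero    v∈X = merge-∈ (X zero) (a zero) (glue k (X ∘ suc) (a ∘ suc) d) v∈X
glue-∈ (suc k) X a d disjoint (suc j) {v} v∈X =
  trans (merge-∉ (X zero) (a zero) (glue k (X ∘ suc) (a ∘ suc) d)
                 (λ v∈X₀ → disjoint zero (suc j) (λ ()) v v∈X₀ v∈X))
        (glue-∈ k (X ∘ suc) (a ∘ suc) d (PairwiseDisjoint-suc disjoint) j v∈X)

dependsOn⇒satisfiable : ∀ {n} {g : BoolFun n} {v} → DependsOn g v → ∃ λ a → g a ≡ true
dependsOn⇒satisfiable {g = g} {v} (a , g≢) with g a in eq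
... | true  = a , eq
... | false = flipAt v a , ¬-not (g≢ ∘ sym)

restrict : ∀ {n} → Subset n → List (Literal n) → List (Literal n)
restrict X = filter (λ l → var l ∈? X)

evalLit-cong : ∀ {n} (l : Literal n) {a b : Assignment n} → a (var l) ≡ b (var l) → evalLit l a ≡ evalLit l b
evalLit-cong (lit v true)  eq = eq
evalLit-cong (lit v false) eq = cong not eq

evalLit-polarity : ∀ {n} {σ : Fin n → Bool} (l : Literal n) → Consistent σ l → evalLit l σ ≡ true
evalLit-polarity (lit v true)  eq = sym eq
evalLit-polarity (lit v false) eq = cong not (sym eq)

evalLit-antipolarity : ∀ {n} {σ : Fin n → Bool} (l : Literal n) → Consistent σ l → evalLit l (not ∘ σ) ≡ false
evalLit-antipolarity (lit v true)  eq = cong not (sym eq)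
evalLit-antipolarity (lit v false) eq = cong (not ∘ not) (sym eq)

allL-polarity : ∀ {n} {σ : Fin n → Bool} t → All (Consistent σ) t → allL t σ ≡ true
allL-polarity []      []         = refl
allL-polarity (l ∷ t) (cl ∷ ct) = cong₂ _∧_ (evalLit-polarity l cl) (allL-polarity t ct)

anyL-false⁺ : ∀ {n} {a : Assignment n} t → All (λ l → evalLit l a ≡ false) t → anyL t a ≡ false
anyL-false⁺ []      []       = refl
anyL-false⁺ (l ∷ t) (e ∷ es) = cong₂ _∨_ e (anyL-false⁺ t es)

anyL-false⁻ : ∀ {n} {a : Assignment n} t → anyL t a ≡ false → All (λ l → evalLit l a ≡ false) t
anyL-false⁻ []      _  = []
anyL-false⁻ (l ∷ t) eq = ∨-conicalˡ _ _ eq ∷ anyL-false⁻ t (∨-conicalʳ _ _ eq)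

allL-merge : ∀ {n} (X : Subset n) {a b} t → All (λ l → var l ∉ X → evalLit l b ≡ true) t →
             allL t (merge X a b) ≡ allL (restrict X t) a
allL-merge X         []      []       = refl
allL-merge X {a} {b} (l ∷ t) (h ∷ hs) with var l ∈? X
... | yes l∈X = cong₂ _∧_ (evalLit-cong l (merge-∈ X a b l∈X)) (allL-merge X t hs)
... | no  l∉X = cong₂ _∧_ (trans (evalLit-cong l (merge-∉ X a b l∉X)) (h l∉X)) (allL-merge X t hs)

anyL-merge : ∀ {n} (X : Subset n) {a b} t → All (λ l → var l ∉ X → evalLit l b ≡ false) t →
             anyL t (merge X a b) ≡ anyL (restrict X t) a
anyL-merge X         []      []       = refl
anyL-merge X {a} {b} (l ∷ t) (h ∷ hs) with var l ∈? X
... | yes l∈X = cong₂ _∨_ (evalLit-cong l (merge-∈ X a b l∈X)) (anyL-merge X t hs)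
... | no  l∉X = cong₂ _∨_ (trans (evalLit-cong l (merge-∉ X a b l∉X)) (h l∉X)) (anyL-merge X t hs)

anyL-restrict-agree : ∀ {n} (X : Subset n) {a b} t → Agree X a b →
                      anyL (restrict X t) a ≡ anyL (restrict X t) b
anyL-restrict-agree X []      ag = refl
anyL-restrict-agree X (l ∷ t) ag with var l ∈? X
... | yes l∈X = cong₂ _∨_ (evalLit-cong l (ag (var l) l∈X)) (anyL-restrict-agree X t ag)
... | no  _   = anyL-restrict-agree X t ag

anyL-restrict⇒anyL : ∀ {n} (X : Subset n) {a} t → anyL (restrict X t) a ≡ true → anyL t a ≡ true
anyL-restrict⇒anyL X          []      ()
anyL-restrict⇒anyL X {a} (l ∷ t) h with var l ∈? X
... | no _ = trans (cong (evalLit l a ∨_) (anyL-restrict⇒anyL X t h)) (∨-zeroʳ _)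
... | yes _ with evalLit l a
...   | true  = refl
...   | false = anyL-restrict⇒anyL X t h

restrict-consistent-glue : ∀ {n} k (X : Fin k → Subset n) (σ : Fin k → Fin n → Bool) d →
                           PairwiseDisjoint (λ i v → v ∈ X i) → ∀ i {c} →
                           All (Consistent (σ i)) c → All (Consistent (glue k X σ d)) (restrict (X i) c)
restrict-consistent-glue k X σ d disjoint i {c} cc =
  All.zipWith (λ { (l∈X , cl) → trans cl (sym (glue-∈ k X σ d disjoint i l∈X)) })
              (all-filter (λ l → var l ∈? X i) c , filter⁺ (λ l → var l ∈? X i) cc)

anyL-glue : ∀ {n} k (X : Fin k → Subset n) a d t → anyL t d ≡ false →
            (∀ j → anyL (restrict (X j) t) (a j) ≡ false) → anyL t (glue k X a d) ≡ false
anyL-glue zero    X a d t t-d _ = t-d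
anyL-glue (suc k) X a d t t-d t-a =
  trans (anyL-merge (X zero) t (All.map (λ e _ → e) (anyL-false⁻ t rest))) (t-a zero)
  where
  rest : anyL t (glue k (X ∘ suc) (a ∘ suc) d) ≡ false
  rest = anyL-glue k (X ∘ suc) (a ∘ suc) d t t-d (t-a ∘ suc)

bigAnd-true : ∀ {n} k (g : Fin k → BoolFun n) a → (∀ i → g i a ≡ true) → bigAnd k g a ≡ true
bigAnd-true zero    g a _  = refl
bigAnd-true (suc k) g a gt = cong₂ _∧_ (gt zero) (bigAnd-true k (g ∘ suc) a (gt ∘ suc))

bigAnd-true⁻ : ∀ {n} k (g : Fin k → BoolFun n) a → bigAnd k g a ≡ true → ∀ i → g i a ≡ true
bigAnd-true⁻ (suc k) g a eq zero    = ∧-conicalˡ _ _ eq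
bigAnd-true⁻ (suc k) g a eq (suc i) = bigAnd-true⁻ k (g ∘ suc) a (∧-conicalʳ _ _ eq) i

bigAnd-others-true : ∀ {n} k (g : Fin k → BoolFun n) a i → (∀ j → j ≢ i → g j a ≡ true) → bigAnd k g a ≡ g i a
bigAnd-others-true (suc k) g a zero    others =
  trans (cong (g zero a ∧_) (bigAnd-true k (g ∘ suc) a (λ j → others (suc j) (λ ())))) (∧-identityʳ _)
bigAnd-others-true (suc k) g a (suc i) others =
  trans (cong (_∧ bigAnd k (g ∘ suc) a) (others zero (λ ())))
        (bigAnd-others-true k (g ∘ suc) a i (λ j j≢i → others (suc j) (j≢i ∘ suc-injective)))

bigAnd-cong : ∀ {n} k (g h : Fin k → BoolFun n) a → (∀ i → g i a ≡ h i a) → bigAnd k g a ≡ bigAnd k h a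
bigAnd-cong zero    g h a _   = refl
bigAnd-cong (suc k) g h a g≡h = cong₂ _∧_ (g≡h zero) (bigAnd-cong k (g ∘ suc) (h ∘ suc) a (g≡h ∘ suc))

restrictNF : ∀ {n} → Subset n → NF n → NF n
restrictNF X = map (restrict X)

restrictNF-consistent : ∀ {n} {σ : Fin n → Bool} (X : Subset n) {F} →
                        All (All (Consistent σ)) F → All (All (Consistent σ)) (restrictNF X F)
restrictNF-consistent X cons = map⁺ (All.map (filter⁺ (λ l → var l ∈? X)) cons)

size-restrictNF : ∀ {n} (X : Subset n) F → size (restrictNF X F) ≤ size F
size-restrictNF X []      = z≤n
size-restrictNF X (t ∷ F) = +-mono-≤ (length-filter (λ l → var l ∈? X) t) (size-restrictNF X F)

sumFin-size-restrictNF : ∀ {n} k (X : Fin k → Subset n) → PairwiseDisjoint (λ i v → v ∈ X i) →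
                         ∀ F → sumFin k (λ i → size (restrictNF (X i) F)) ≤ size F
sumFin-size-restrictNF k X disjoint []      = ≤-reflexive (sumFin-zero k (λ _ → refl))
sumFin-size-restrictNF k X disjoint (t ∷ F) = begin
  sumFin k (λ i → length (restrict (X i) t) + size (restrictNF (X i) F))
    ≡⟨ sumFin-+ k _ _ ⟩
  sumFin k (λ i → length (restrict (X i) t)) + sumFin k (λ i → size (restrictNF (X i) F))
    ≤⟨ +-mono-≤ (sumFin-length-filter k (λ i l → var l ∈? X i) (λ i j i≢j l → disjoint i j i≢j (var l)) t)
                (sumFin-size-restrictNF k X disjoint F) ⟩
  length t + size F ∎
  where open ≤-Reasoning

evalDNF-restrictNF : ∀ {n} {σ : Fin n → Bool} (X : Subset n) a F →
                     All (All (Consistent σ)) F → evalDNF (restrictNF X F) a ≡ evalDNF F (merge X a σ)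
evalDNF-restrictNF X a []      []         = refl
evalDNF-restrictNF X a (t ∷ F) (ct ∷ cF) =
  cong₂ _∨_ (sym (allL-merge X t (All.map (λ cl _ → evalLit-polarity _ cl) ct))) (evalDNF-restrictNF X a F cF)

evalCNF-restrictNF : ∀ {n} {σ : Fin n → Bool} (X : Subset n) a F →
                     All (All (Consistent σ)) F → evalCNF (restrictNF X F) a ≡ evalCNF F (merge X a (not ∘ σ))
evalCNF-restrictNF X a []      []         = refl
evalCNF-restrictNF X a (c ∷ F) (cc ∷ cF) =
  cong₂ _∧_ (sym (anyL-merge X c (All.map (λ cl _ → evalLit-antipolarity _ cl) cc)))
            (evalCNF-restrictNF X a F cF)

evalDNF-polarity : ∀ {n} {σ : Fin n → Bool} {a} F → All (All (Consistent σ)) F →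
                   evalDNF F a ≡ true → evalDNF F σ ≡ true
evalDNF-polarity (t ∷ F) (ct ∷ _) _ = cong (_∨ evalDNF F _) (allL-polarity t ct)

evalCNF-true⁻ : ∀ {n} {a : Assignment n} F → evalCNF F a ≡ true → All (λ c → anyL c a ≡ true) F
evalCNF-true⁻ []      _  = []
evalCNF-true⁻ (c ∷ F) eq = ∧-conicalˡ _ _ eq ∷ evalCNF-true⁻ F (∧-conicalʳ _ _ eq)

concatNF : ∀ {n} k → (Fin k → NF n) → NF n
concatNF zero    G = []
concatNF (suc k) G = G zero ++ concatNF k (G ∘ suc)

evalCNF-++ : ∀ {n} (G H : NF n) a → evalCNF (G ++ H) a ≡ evalCNF G a ∧ evalCNF H a
evalCNF-++ []      H a = refl
evalCNF-++ (c ∷ G) H a = trans (cong (anyL c a ∧_) (evalCNF-++ G H a)) (sym (∧-assoc (anyL c a) _ _))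

evalCNF-concatNF : ∀ {n} k (G : Fin k → NF n) a → evalCNF (concatNF k G) a ≡ bigAnd k (λ i → evalCNF (G i)) a
evalCNF-concatNF zero    G a = refl
evalCNF-concatNF (suc k) G a =
  trans (evalCNF-++ (G zero) _ a) (cong (evalCNF (G zero) a ∧_) (evalCNF-concatNF k (G ∘ suc) a))

size-++ : ∀ {n} (G H : NF n) → size (G ++ H) ≡ size G + size H
size-++ G H = trans (cong sum (map-++ length G H)) (sum-++ (map length G) (map length H))

size-concatNF : ∀ {n} k (G : Fin k → NF n) → size (concatNF k G) ≡ sumFin k (λ i → size (G i))
size-concatNF zero    G = refl
size-concatNF (suc k) G = trans (size-++ (G zero) _) (cong (size (G zero) +_) (size-concatNF k (G ∘ suc)))

All-concatNF : ∀ {n} {P : List (Literal n) → Set} k (G : Fin k → NF n) →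
               (∀ i → All P (G i)) → All P (concatNF k G)
All-concatNF zero    G _  = []
All-concatNF (suc k) G pG = ++⁺ (pG zero) (All-concatNF k (G ∘ suc) (pG ∘ suc))

module DisjointConjunction {n k : ℕ} (X : Fin k → Subset n) (f : Fin k → BoolFun n)
  (disjoint : PairwiseDisjoint (λ i v → v ∈ X i))
  (local : ∀ i → DependsOnlyOn (f i) (X i))
  (satisfiable : ∀ i → ∃ λ a → f i a ≡ true) where

  f-merge-others : ∀ {i j} → j ≢ i → ∀ a b → f j (merge (X i) a b) ≡ f j b
  f-merge-others {i} {j} j≢i a b =
    local j _ _ (λ v v∈Xj → merge-∉ (X i) a b (λ v∈Xi → disjoint i j (j≢i ∘ sym) v v∈Xi v∈Xj))

  f-merge-self : ∀ i a b → f i (merge (X i) a b) ≡ f i a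
  f-merge-self i a b = local i _ _ (λ v → merge-∈ (X i) a b)

  bigAnd-merge : ∀ i a {b} → (∀ j → f j b ≡ true) → bigAnd k f (merge (X i) a b) ≡ f i a
  bigAnd-merge i a {b} fb =
    trans (bigAnd-others-true k f _ i (λ j j≢i → trans (f-merge-others j≢i a b) (fb j))) (f-merge-self i a b)

  f-glue : ∀ a d j → f j (glue k X a d) ≡ f j (a j)
  f-glue a d j = local j _ _ (λ v → glue-∈ k X a d disjoint j)

  witness : Assignment n
  witness = glue k X (proj₁ ∘ satisfiable) (λ _ → false)

  witness-satisfies : ∀ j → f j witness ≡ true
  witness-satisfies j = trans (f-glue _ _ j) (proj₂ (satisfiable j))

  restrictNF-computes-DNF : ∀ {F σ} → All (All (Consistent σ)) F → (∀ a → evalDNF F a ≡ bigAnd k f a) →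
                            ∀ i a → evalDNF (restrictNF (X i) F) a ≡ f i a
  restrictNF-computes-DNF {F} {σ} cF computesF i a = begin
    evalDNF (restrictNF (X i) F) a  ≡⟨ evalDNF-restrictNF (X i) a F cF ⟩
    evalDNF F (merge (X i) a σ)     ≡⟨ computesF _ ⟩
    bigAnd k f (merge (X i) a σ)    ≡⟨ bigAnd-merge i a (bigAnd-true⁻ k f σ σ-satisfies) ⟩
    f i a                           ∎
    where
    open ≡-Reasoning
    σ-satisfies : bigAnd k f σ ≡ true
    σ-satisfies = trans (sym (computesF σ))
      (evalDNF-polarity F cF (trans (computesF witness) (bigAnd-true k f witness witness-satisfies)))

  uDNF-superadditive : ∀ m ms → UDNFs (bigAnd k f) m → (∀ i → UDNFs (f i) (ms i)) → sumFin k ms ≤ m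
  uDNF-superadditive _ ms ((F , ((σ , cF) , computesF) , refl) , _) optimal = begin
    sumFin k ms                                 ≤⟨ sumFin-mono k (λ i → proj₂ (optimal i) _ (isUDNF i)) ⟩
    sumFin k (λ i → size (restrictNF (X i) F))  ≤⟨ sumFin-size-restrictNF k X disjoint F ⟩
    size F                                      ∎
    where
    open ≤-Reasoning
    isUDNF : ∀ i → IsUDNF (restrictNF (X i) F) (f i)
    isUDNF i = (σ , restrictNF-consistent (X i) cF) , restrictNF-computes-DNF cF computesF i

  restrictedConcat : (Fin k → NF n) → NF n
  restrictedConcat G = concatNF k (λ i → restrictNF (X i) (G i))

  restrictedConcat-isUCNF : (G : Fin k → NF n) → (∀ i → IsUCNF (G i) (f i)) →
                            IsUCNF (restrictedConcat G) (bigAnd k f)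
  restrictedConcat-isUCNF G isUCNF = (σ , consistent) , computes
    where
    σᵢ : Fin k → Fin n → Bool
    σᵢ i = proj₁ (proj₁ (isUCNF i))
    cG : ∀ i → All (All (Consistent (σᵢ i))) (G i)
    cG i = proj₂ (proj₁ (isUCNF i))
    σ : Fin n → Bool
    σ = glue k X σᵢ (λ _ → false)
    consistent : All (All (Consistent σ)) (restrictedConcat G)
    consistent = All-concatNF k _ (λ i → map⁺ (All.map (restrict-consistent-glue k X σᵢ _ disjoint i) (cG i)))
    computes : ∀ a → evalCNF (restrictedConcat G) a ≡ bigAnd k f a
    computes a = trans (evalCNF-concatNF k _ a) (bigAnd-cong k _ f a (λ i → begin
      evalCNF (restrictNF (X i) (G i)) a           ≡⟨ evalCNF-restrictNF (X i) a (G i) (cG i) ⟩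
      evalCNF (G i) (merge (X i) a (not ∘ σᵢ i))  ≡⟨ proj₂ (isUCNF i) _ ⟩
      f i (merge (X i) a (not ∘ σᵢ i))            ≡⟨ f-merge-self i a _ ⟩
      f i a                                        ∎))
      where open ≡-Reasoning

  uCNF-subadditive : ∀ m ms → UCNFs (bigAnd k f) m → (∀ i → UCNFs (f i) (ms i)) → m ≤ sumFin k ms
  uCNF-subadditive m ms (_ , minimal) optimal = begin
    m                                               ≤⟨ minimal _ (restrictedConcat-isUCNF G isUCNF) ⟩
    size (restrictedConcat G)                       ≡⟨ size-concatNF k _ ⟩
    sumFin k (λ i → size (restrictNF (X i) (G i)))  ≤⟨ sumFin-mono k restricted≤ms ⟩
    sumFin k ms                                     ∎
    where
    open ≤-Reasoning
    G : Fin k → NF n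
    G i = proj₁ (proj₁ (optimal i))
    isUCNF : ∀ i → IsUCNF (G i) (f i)
    isUCNF i = proj₁ (proj₂ (proj₁ (optimal i)))
    restricted≤ms : ∀ i → size (restrictNF (X i) (G i)) ≤ ms i
    restricted≤ms i = ≤-trans (size-restrictNF (X i) (G i)) (≤-reflexive (proj₂ (proj₂ (proj₁ (optimal i)))))

  Owner : Fin k → List (Literal n) → Set
  Owner j c = ∀ a → f j a ≡ true → anyL (restrict (X j) c) a ≡ true

  Owned : List (Literal n) → Set
  Owned c = ∃ λ j → Owner j c

  -- Otherwise glue, for every j, a model of fⱼ falsifying the Xⱼ-ownedClauses of c, with ¬σ
  -- elsewhere: this is a model of ⋀ fⱼ falsifying c.
  clause-owned : ∀ {σ c} → All (Consistent σ) c → (∀ a → bigAnd k f a ≡ true → anyL c a ≡ true) → ¬ ¬ Owned c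
  clause-owned {σ} {c} cc implied unowned = ¬¬-∀Fin k counterexample λ cex →
    let A = glue k X (proj₁ ∘ cex) (not ∘ σ) in
    not-¬ (implied A (bigAnd-true k f A (λ j → trans (f-glue _ _ j) (proj₁ (proj₂ (cex j))))))
          (anyL-glue k X _ _ c (anyL-false⁺ c (All.map (evalLit-antipolarity _) cc)) (proj₂ ∘ proj₂ ∘ cex))
    where
    counterexample : ∀ j → ¬ ¬ (∃ λ a → f j a ≡ true × anyL (restrict (X j) c) a ≡ false)
    counterexample j none = unowned (j , λ a fa → ¬-not (λ e → none (a , fa , e)))

  clauses-owned : ∀ {σ} F → All (All (Consistent σ)) F → (∀ a → bigAnd k f a ≡ true → evalCNF F a ≡ true) →
                  ¬ ¬ All Owned F
  clauses-owned F cF implied =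
    ¬¬-All F (All.zipWith (λ { (cc , imp) → clause-owned cc imp }) (cF , implied-clauses))
    where
    implied-clauses : All (λ c → ∀ a → bigAnd k f a ≡ true → anyL c a ≡ true) F
    implied-clauses = All.tabulate (λ c∈F a fa → All.lookup (evalCNF-true⁻ F (implied a fa)) c∈F)

  ownedClauses : ∀ {F} → All Owned F → Fin k → NF n
  ownedClauses {[]}    []             i = []
  ownedClauses {c ∷ F} ((j , _) ∷ os) i with j ≟ i
  ... | yes _ = restrict (X i) c ∷ ownedClauses os i
  ... | no  _ = ownedClauses os i

  size-ownedClauses : ∀ {F} (os : All Owned F) i → size (ownedClauses os i) ≤ size (restrictNF (X i) F)
  size-ownedClauses {[]}    []             i = z≤n
  size-ownedClauses {c ∷ F} ((j , _) ∷ os) i with j ≟ i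
  ... | yes _ = +-monoʳ-≤ (length (restrict (X i) c)) (size-ownedClauses os i)
  ... | no  _ = ≤-trans (size-ownedClauses os i) (m≤n+m _ _)

  ownedClauses-consistent : ∀ {σ F} (os : All Owned F) i →
                    All (All (Consistent σ)) F → All (All (Consistent σ)) (ownedClauses os i)
  ownedClauses-consistent                 []             i []         = []
  ownedClauses-consistent {F = c ∷ F} ((j , _) ∷ os) i (cc ∷ cF) with j ≟ i
  ... | yes _ = filter⁺ (λ l → var l ∈? X i) cc ∷ ownedClauses-consistent os i cF
  ... | no  _ = ownedClauses-consistent os i cF

  ownedClauses-sound : ∀ {F} (os : All Owned F) i a → f i a ≡ true → evalCNF (ownedClauses os i) a ≡ true
  ownedClauses-sound []               i a fa = refl
  ownedClauses-sound ((j , own) ∷ os) i a fa with j ≟ i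
  ... | yes refl = cong₂ _∧_ (own a fa) (ownedClauses-sound os i a fa)
  ... | no  _    = ownedClauses-sound os i a fa

  ownedClauses-complete : ∀ {F} (os : All Owned F) i a → evalCNF (ownedClauses os i) a ≡ true →
                  evalCNF F (merge (X i) a witness) ≡ true
  ownedClauses-complete {[]}    []               i a _ = refl
  ownedClauses-complete {c ∷ F} ((j , own) ∷ os) i a h with j ≟ i
  ... | yes refl = cong₂ _∧_
    (anyL-restrict⇒anyL (X i) c
      (trans (anyL-restrict-agree (X i) c (λ v → merge-∈ (X i) a witness)) (∧-conicalˡ _ _ h)))
    (ownedClauses-complete os i a (∧-conicalʳ _ _ h))
  ... | no  j≢i  = cong₂ _∧_
    (anyL-restrict⇒anyL (X j) c (own _ (trans (f-merge-others j≢i a witness) (witness-satisfies j))))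
    (ownedClauses-complete os i a h)

  ownedClauses-computes : ∀ {F} → (∀ a → evalCNF F a ≡ bigAnd k f a) → (os : All Owned F) →
                  ∀ i a → evalCNF (ownedClauses os i) a ≡ f i a
  ownedClauses-computes {F} computesF os i a = ⇔→≡ (mk⇔ complete (ownedClauses-sound os i a))
    where
    open ≡-Reasoning
    complete : evalCNF (ownedClauses os i) a ≡ true → f i a ≡ true
    complete h = begin
      f i a                                ≡⟨ sym (bigAnd-merge i a witness-satisfies) ⟩
      bigAnd k f (merge (X i) a witness)   ≡⟨ sym (computesF _) ⟩
      evalCNF F (merge (X i) a witness)    ≡⟨ ownedClauses-complete os i a h ⟩
      true                                 ∎

  -- Owners are chosen classically, which suffices as the goal is a decidable inequality.
  uCNF-superadditive : ∀ m ms → UCNFs (bigAnd k f) m → (∀ i → UCNFs (f i) (ms i)) → sumFin k ms ≤ m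
  uCNF-superadditive _ ms ((F , ((σ , cF) , computesF) , refl) , _) optimal =
    decidable-stable (sumFin k ms ≤? size F) (¬¬-map bound (clauses-owned F cF implied))
    where
    implied : ∀ a → bigAnd k f a ≡ true → evalCNF F a ≡ true
    implied a fa = trans (computesF a) fa
    bound : All Owned F → sumFin k ms ≤ size F
    bound os = begin
      sumFin k ms                                 ≤⟨ sumFin-mono k (λ i → proj₂ (optimal i) _ (isUCNF i)) ⟩
      sumFin k (λ i → size (ownedClauses os i))           ≤⟨ sumFin-mono k (size-ownedClauses os) ⟩
      sumFin k (λ i → size (restrictNF (X i) F))  ≤⟨ sumFin-size-restrictNF k X disjoint F ⟩
      size F                                      ∎
      where
      open ≤-Reasoning
      isUCNF : ∀ i → IsUCNF (ownedClauses os i) (f i)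
      isUCNF i = (σ , ownedClauses-consistent os i cF) , ownedClauses-computes computesF os i

mainTheorem14 : (n k : ℕ) (X : Fin k → Subset n) (f : Fin k → BoolFun n)
    → (∀ i → ∃ λ v → v ∈ X i)
    → (∀ i j → i ≢ j → ∀ v → v ∈ X i → v ∈ X j → ⊥)
    → (∀ i → DependsOnlyOn (f i) (X i))
    → (∀ i → ∀ v → v ∈ X i → DependsOn (f i) v)
    → (∀ i → Unate (f i))
    → ((m : ℕ) (ms : Fin k → ℕ) → UDNFs (bigAnd k f) m → (∀ i → UDNFs (f i) (ms i))
         → sumFin k ms ≤ m)
      × ((m : ℕ) (ms : Fin k → ℕ) → UCNFs (bigAnd k f) m → (∀ i → UCNFs (f i) (ms i))
         → m ≡ sumFin k ms)
mainTheorem14 n k X f nonempty disjoint local dependent _ =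
  uDNF-superadditive ,
  λ m ms uCNF optimal → ≤-antisym (uCNF-subadditive m ms uCNF optimal) (uCNF-superadditive m ms uCNF optimal)
  where
  open DisjointConjunction X f disjoint local
         (λ i → dependsOn⇒satisfiable (dependent i _ (proj₂ (nonempty i))))
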